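{- Let $p\ge 0$ and $t\ge 0$ be integers with $p+t\le 64$, and let $K:=(65-p-t)\,2^t$. Define, for integers $k\ge 0$, $$h(k):=\min\!\left(t+1+\left\lfloor \frac{k-1}{2^t}\right\rfloor,\;64-p\right),$$ and for integers $k\in[1,K]$ define $\rho(k):=2^{ -h(k)}$. Then for every integer $u$ with $0\le u\le K$, $$\sum_{k=u+1}^{K}\rho(k)=\frac{2^{t}\bigl(1-t+h(u)\bigr)-u}{2^{h(u)}}.$$
   Context: Here $\lfloor\cdot\rfloor$ denotes the floor function (so for $k=0$, $\lfloor -1/2^t\rfloor=-1$). The function $\rho$ is the probability mass function of update values in the ExaLogLog sketch with precision parameter $p$ and parameter $t$; an empty sum (for $u=K$) equals $0$. -}

module Defs where

open import Data.Nat as ℕ using (ℕ; zero; suc; _+_; _*_; _∸_; _^_; _⊓_; NonZero)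
open import Data.Nat.DivMod using (_/_)
open import Data.Nat.Properties using (m^n≢0)
open import Data.Integer as ℤ using (ℤ; +_)
open import Data.Rational as ℚ using (ℚ; 0ℚ)

_/2^_ : ℤ → ℕ → ℚ
z /2^ n = ℚ._/_ z (2 ^ n) {{m^n≢0 2 n}}

-- ⌊ (k - 1) / 2^t ⌋ as an integer shifted by +1, i.e.  1 + ⌊(k-1)/2^t⌋ ∈ ℕ.
-- For k = 0 this is 1 + (-1) = 0; for k = suc j it is 1 + ⌊ j / 2^t ⌋.
onePlusFloor : (t k : ℕ) → ℕ
onePlusFloor t zero    = 0
onePlusFloor t (suc j) = suc (_/_ j (2 ^ t) {{m^n≢0 2 t}})

h : (p t k : ℕ) → ℕ
h p t k = (t + onePlusFloor t k) ⊓ (64 ∸ p)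

ρ : (p t k : ℕ) → ℚ
ρ p t k = (+ 1) /2^ h p t k

K : (p t : ℕ) → ℕ
K p t = (65 ∸ p ∸ t) * 2 ^ t

sumFrom : (ℕ → ℚ) → ℕ → ℕ → ℚ
sumFrom f a zero    = 0ℚ
sumFrom f a (suc n) = f a ℚ.+ sumFrom f (suc a) n

sumRange : (ℕ → ℚ) → (u K : ℕ) → ℚ
sumRange f u K = sumFrom f (suc u) (K ∸ u)

-- The right-hand side C(u) = (2^t (1 - t + h(u)) - u) / 2^h(u) vanishes at u = K and satisfies
-- C(u) = ρ(u + 1) + C(u + 1) for u < K, so the sum telescopes. Where h(u + 1) = h(u) this is just
-- the numerator dropping by one. Otherwise u = q 2^t and h(u) = t + q, and at such a point C(u)
-- equals 2^-q whether it is evaluated with exponent t + q or t + q + 1.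
module Submission where

open import Defs
open import Data.Nat as ℕ using (ℕ; zero; suc; _+_; _*_; _∸_; _^_; _≤_; _<_; _⊓_; NonZero)
import Data.Nat.Properties as ℕP
open import Data.Nat.DivMod as ℕD using (_/_; _%_)
open import Data.Nat.Divisibility using (n∣m*n)
open import Data.Integer as ℤ using (ℤ; +_; 0ℤ)
import Data.Integer.Properties as ℤP
open import Data.Integer.Tactic.RingSolver using (solve-∀)
open import Data.Rational as ℚ using (ℚ; 0ℚ)
import Data.Rational.Properties as ℚP
open import Data.Rational.Unnormalised as ℚᵘ using (mkℚᵘ; *≡*)
import Data.Rational.Unnormalised.Properties as ℚᵘP
open import Data.Product using (∃₂; _×_; _,_)
open import Data.Sum using (inj₁; inj₂)
open import Relation.Binary.PropositionalEquality

+-distrib-/ : ∀ a b d .{{_ : NonZero d}} → (a ℤ.+ b) ℚ./ d ≡ a ℚ./ d ℚ.+ b ℚ./ d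
+-distrib-/ a b d@(suc c) = ℚP.toℚᵘ-injective (begin
    ℚ.toℚᵘ (ℚ.fromℚᵘ (mkℚᵘ (a ℤ.+ b) c))
      ≈⟨ ℚP.toℚᵘ-fromℚᵘ (mkℚᵘ (a ℤ.+ b) c) ⟩
    mkℚᵘ (a ℤ.+ b) c
      ≈⟨ *≡* cross ⟩
    mkℚᵘ a c ℚᵘ.+ mkℚᵘ b c
      ≈⟨ ℚᵘP.+-cong (ℚP.toℚᵘ-fromℚᵘ (mkℚᵘ a c)) (ℚP.toℚᵘ-fromℚᵘ (mkℚᵘ b c)) ⟨
    ℚ.toℚᵘ (a ℚ./ d) ℚᵘ.+ ℚ.toℚᵘ (b ℚ./ d)
      ≈⟨ ℚP.toℚᵘ-homo-+ (a ℚ./ d) (b ℚ./ d) ⟨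
    ℚ.toℚᵘ (a ℚ./ d ℚ.+ b ℚ./ d)
      ∎)
  where
  open ℚᵘP.≃-Reasoning
  distrib : ∀ a b s → (a ℤ.+ b) ℤ.* (s ℤ.* s) ≡ (a ℤ.* s ℤ.+ b ℤ.* s) ℤ.* s
  distrib = solve-∀
  cross : (a ℤ.+ b) ℤ.* + (d * d) ≡ (a ℤ.* + d ℤ.+ b ℤ.* + d) ℤ.* + d
  cross = trans (cong ((a ℤ.+ b) ℤ.*_) (ℤP.pos-* d d)) (distrib a b (+ d))

/-cong-cross : ∀ a b c d .{{_ : NonZero c}} .{{_ : NonZero d}} →
               a ℤ.* + d ≡ b ℤ.* + c → a ℚ./ c ≡ b ℚ./ d
/-cong-cross a b (suc c) (suc d) eq = ℚP.fromℚᵘ-cong {mkℚᵘ a c} {mkℚᵘ b d} (*≡* eq)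

[a+a]/2^[1+n]≡a/2^n : ∀ a n → (a ℤ.+ a) /2^ suc n ≡ a /2^ n
[a+a]/2^[1+n]≡a/2^n a n =
  /-cong-cross (a ℤ.+ a) a (2 ^ suc n) (2 ^ n) {{ℕP.m^n≢0 2 (suc n)}} {{ℕP.m^n≢0 2 n}}
    (trans (double a (+ (2 ^ n))) (cong (a ℤ.*_) (sym (ℤP.pos-* 2 (2 ^ n)))))
  where
  double : ∀ a s → (a ℤ.+ a) ℤ.* s ≡ a ℤ.* (+ 2 ℤ.* s)
  double = solve-∀

0/2^n≡0 : ∀ n → 0ℤ /2^ n ≡ 0ℚ
0/2^n≡0 n = ℚP.0/n≡0 (2 ^ n) {{ℕP.m^n≢0 2 n}}

numerator : (t H u : ℕ) → ℤ
numerator t H u = + (2 ^ t) ℤ.* (+ 1 ℤ.- + t ℤ.+ + H) ℤ.- + u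

closedForm : (t H u : ℕ) → ℚ
closedForm t H u = numerator t H u /2^ H

numerator-suc-level : ∀ t H u → numerator t (suc H) u ≡ + (2 ^ t) ℤ.+ numerator t H u
numerator-suc-level t H u = identity (+ (2 ^ t)) (+ t) (+ H) (+ u)
  where
  identity : ∀ T t H u → T ℤ.* (+ 1 ℤ.- t ℤ.+ (+ 1 ℤ.+ H)) ℤ.- u ≡ T ℤ.+ (T ℤ.* (+ 1 ℤ.- t ℤ.+ H) ℤ.- u)
  identity = solve-∀

numerator-suc : ∀ t H u → + 1 ℤ.+ numerator t H (suc u) ≡ numerator t H u
numerator-suc t H u = identity (+ (2 ^ t) ℤ.* (+ 1 ℤ.- + t ℤ.+ + H)) (+ u)
  where
  identity : ∀ x u → + 1 ℤ.+ (x ℤ.- (+ 1 ℤ.+ u)) ≡ x ℤ.- u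
  identity = solve-∀

numerator-block-start : ∀ t q → numerator t (t + q) (q * 2 ^ t) ≡ + (2 ^ t)
numerator-block-start t q =
  trans (cong₂ (λ H u → + (2 ^ t) ℤ.* (+ 1 ℤ.- + t ℤ.+ H) ℤ.- u)
               (ℤP.pos-+ t q) (ℤP.pos-* q (2 ^ t)))
        (identity (+ (2 ^ t)) (+ t) (+ q))
  where
  identity : ∀ T t q → T ℤ.* (+ 1 ℤ.- t ℤ.+ (t ℤ.+ q)) ℤ.- q ℤ.* T ≡ T
  identity = solve-∀

numerator-end : ∀ t e → numerator t (t + e) (suc e * 2 ^ t) ≡ 0ℤ
numerator-end t e =
  trans (cong₂ (λ H u → + (2 ^ t) ℤ.* (+ 1 ℤ.- + t ℤ.+ H) ℤ.- u)
               (ℤP.pos-+ t e) (ℤP.pos-* (suc e) (2 ^ t)))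
        (identity (+ (2 ^ t)) (+ t) (+ e))
  where
  identity : ∀ T t e → T ℤ.* (+ 1 ℤ.- t ℤ.+ (t ℤ.+ e)) ℤ.- (+ 1 ℤ.+ e) ℤ.* T ≡ 0ℤ
  identity = solve-∀

closedForm-suc : ∀ t H u → (+ 1) /2^ H ℚ.+ closedForm t H (suc u) ≡ closedForm t H u
closedForm-suc t H u = begin
  (+ 1) /2^ H ℚ.+ numerator t H (suc u) /2^ H
    ≡⟨ +-distrib-/ (+ 1) (numerator t H (suc u)) (2 ^ H) {{ℕP.m^n≢0 2 H}} ⟨
  (+ 1 ℤ.+ numerator t H (suc u)) /2^ H
    ≡⟨ cong (_/2^ H) (numerator-suc t H u) ⟩
  numerator t H u /2^ H
    ∎
  where open ≡-Reasoning

closedForm-block-start : ∀ t q →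
  closedForm t (suc (t + q)) (q * 2 ^ t) ≡ closedForm t (t + q) (q * 2 ^ t)
closedForm-block-start t q = begin
  numerator t (suc (t + q)) (q * 2 ^ t) /2^ suc (t + q)
    ≡⟨ cong (_/2^ suc (t + q)) (numerator-suc-level t (t + q) (q * 2 ^ t)) ⟩
  (T ℤ.+ numerator t (t + q) (q * 2 ^ t)) /2^ suc (t + q)
    ≡⟨ cong (λ x → (T ℤ.+ x) /2^ suc (t + q)) (numerator-block-start t q) ⟩
  (T ℤ.+ T) /2^ suc (t + q)
    ≡⟨ [a+a]/2^[1+n]≡a/2^n T (t + q) ⟩
  T /2^ (t + q)
    ≡⟨ cong (_/2^ (t + q)) (numerator-block-start t q) ⟨
  numerator t (t + q) (q * 2 ^ t) /2^ (t + q)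
    ∎
  where
  open ≡-Reasoning
  T : ℤ
  T = + (2 ^ t)

[o+m*n]/n≡m : ∀ {o} m n .{{_ : NonZero n}} → o < n → (o + m * n) / n ≡ m
[o+m*n]/n≡m {o} m n o<n = begin
  (o + m * n) / n    ≡⟨ ℕD.+-distrib-/-∣ʳ o (n∣m*n m) ⟩
  o / n + m * n / n  ≡⟨ cong₂ _+_ (ℕD.m<n⇒m/n≡0 o<n) (ℕD.m*n/n≡m m n) ⟩
  m                  ∎
  where open ≡-Reasoning

division-with-remainder : ∀ u d .{{_ : NonZero d}} → ∃₂ λ q r → r < d × u ≡ r + q * d
division-with-remainder u d = u / d , u % d , ℕD.m%n<n u d , ℕD.m≡m%n+[m/n]*n u d

onePlusFloor-[1+r+q*2^t]≡1+q : ∀ t q {r} → r < 2 ^ t → onePlusFloor t (suc (r + q * 2 ^ t)) ≡ suc q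
onePlusFloor-[1+r+q*2^t]≡1+q t q r<2^t = cong suc ([o+m*n]/n≡m q (2 ^ t) {{ℕP.m^n≢0 2 t}} r<2^t)

onePlusFloor-[q*2^t]≡q : ∀ t q → onePlusFloor t (q * 2 ^ t) ≡ q
onePlusFloor-[q*2^t]≡q t zero    = refl
onePlusFloor-[q*2^t]≡q t (suc q) = begin
  onePlusFloor t (2 ^ t + q * 2 ^ t)
    ≡⟨ cong (λ n → onePlusFloor t (n + q * 2 ^ t)) 2^t≡1+pred ⟩
  onePlusFloor t (suc (ℕ.pred (2 ^ t) + q * 2 ^ t))
    ≡⟨ onePlusFloor-[1+r+q*2^t]≡1+q t q (ℕP.≤-reflexive (sym 2^t≡1+pred)) ⟩
  suc q
    ∎
  where
  open ≡-Reasoning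
  2^t≡1+pred : 2 ^ t ≡ suc (ℕ.pred (2 ^ t))
  2^t≡1+pred = sym (ℕP.suc-pred (2 ^ t) {{ℕP.m^n≢0 2 t}})

-- h p t is definitionally level t (64 ∸ p); writing the cap 64 ∸ p as t + e makes K p t = (1 + e) 2^t.
level : (t M u : ℕ) → ℕ
level t M u = (t + onePlusFloor t u) ⊓ M

level-[q*2^t] : ∀ t M q → level t M (q * 2 ^ t) ≡ (t + q) ⊓ M
level-[q*2^t] t M q = cong (λ n → (t + n) ⊓ M) (onePlusFloor-[q*2^t]≡q t q)

level-[1+q*2^t] : ∀ t M q → level t M (suc (q * 2 ^ t)) ≡ (t + suc q) ⊓ M
level-[1+q*2^t] t M q = cong (λ n → (t + n) ⊓ M) (onePlusFloor-[1+r+q*2^t]≡1+q t q (ℕP.m^n>0 2 t))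

closedForm-level-suc : ∀ t e u → u < suc e * 2 ^ t →
  closedForm t (level t (t + e) (suc u)) u ≡ closedForm t (level t (t + e) u) u
closedForm-level-suc t e u u<K with division-with-remainder u (2 ^ t) {{ℕP.m^n≢0 2 t}}
... | q , suc r , 1+r<2^t , refl =
  cong (λ n → closedForm t ((t + n) ⊓ (t + e)) u)
       (trans (onePlusFloor-[1+r+q*2^t]≡1+q t q 1+r<2^t)
              (sym (onePlusFloor-[1+r+q*2^t]≡1+q t q (ℕP.<⇒≤ 1+r<2^t))))
... | q , zero , _ , refl with ℕP.m≤n⇒m<n∨m≡n (ℕP.≤-pred (ℕP.*-cancelʳ-< (2 ^ t) q (suc e) u<K))
...   | inj₁ q<e = begin
  closedForm t (level t (t + e) (suc u)) u  ≡⟨ cong (λ H → closedForm t H u) level-suc-u ⟩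
  closedForm t (suc (t + q)) u              ≡⟨ closedForm-block-start t q ⟩
  closedForm t (t + q) u                    ≡⟨ cong (λ H → closedForm t H u) level-u ⟨
  closedForm t (level t (t + e) u) u        ∎
  where
  open ≡-Reasoning
  level-suc-u : level t (t + e) (suc u) ≡ suc (t + q)
  level-suc-u = trans (level-[1+q*2^t] t (t + e) q)
                      (trans (ℕP.m≤n⇒m⊓n≡m (ℕP.+-monoʳ-≤ t q<e)) (ℕP.+-suc t q))
  level-u : level t (t + e) u ≡ t + q
  level-u = trans (level-[q*2^t] t (t + e) q) (ℕP.m≤n⇒m⊓n≡m (ℕP.+-monoʳ-≤ t (ℕP.<⇒≤ q<e)))
...   | inj₂ refl = cong (λ H → closedForm t H u) (trans level-suc-u (sym level-u))
  where
  level-suc-u : level t (t + q) (suc u) ≡ t + q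
  level-suc-u = trans (level-[1+q*2^t] t (t + q) q) (ℕP.m≥n⇒m⊓n≡n (ℕP.+-monoʳ-≤ t (ℕP.n≤1+n q)))
  level-u : level t (t + q) u ≡ t + q
  level-u = trans (level-[q*2^t] t (t + q) q) (ℕP.⊓-idem (t + q))

closedForm-level-end : ∀ t e → closedForm t (level t (t + e) (suc e * 2 ^ t)) (suc e * 2 ^ t) ≡ 0ℚ
closedForm-level-end t e = begin
  closedForm t (level t (t + e) n) n  ≡⟨ cong (λ H → closedForm t H n) level-n ⟩
  numerator t (t + e) n /2^ (t + e)   ≡⟨ cong (_/2^ (t + e)) (numerator-end t e) ⟩
  0ℤ /2^ (t + e)                      ≡⟨ 0/2^n≡0 (t + e) ⟩
  0ℚ                                  ∎
  where
  open ≡-Reasoning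
  n : ℕ
  n = suc e * 2 ^ t
  level-n : level t (t + e) n ≡ t + e
  level-n = trans (level-[q*2^t] t (t + e) (suc e)) (ℕP.m≥n⇒m⊓n≡n (ℕP.+-monoʳ-≤ t (ℕP.n≤1+n e)))

sumRange-telescope : (f g : ℕ → ℚ) (n : ℕ) → (∀ u → u < n → f (suc u) ℚ.+ g (suc u) ≡ g u) →
                     g n ≡ 0ℚ → ∀ u → u ≤ n → sumRange f u n ≡ g u
sumRange-telescope f g n step end u u≤n = go (n ∸ u) u (ℕP.m+[n∸m]≡n u≤n)
  where
  go : ∀ d u → u + d ≡ n → sumFrom f (suc u) d ≡ g u
  go zero    u u+0≡n = sym (trans (cong g (trans (sym (ℕP.+-identityʳ u)) u+0≡n)) end)
  go (suc d) u u+d≡n = begin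
    f (suc u) ℚ.+ sumFrom f (suc (suc u)) d
      ≡⟨ cong (f (suc u) ℚ.+_) (go d (suc u) (trans (sym (ℕP.+-suc u d)) u+d≡n)) ⟩
    f (suc u) ℚ.+ g (suc u)
      ≡⟨ step u (subst (u <_) u+d≡n (ℕP.m<m+n u ℕ.z<s)) ⟩
    g u
      ∎
    where open ≡-Reasoning

sumRange-level : ∀ t e u → u ≤ suc e * 2 ^ t →
  sumRange (λ k → (+ 1) /2^ level t (t + e) k) u (suc e * 2 ^ t) ≡ closedForm t (level t (t + e) u) u
sumRange-level t e = sumRange-telescope _ (λ u → closedForm t (level t (t + e) u) u) (suc e * 2 ^ t)
  (λ u u<K → trans (closedForm-suc t _ u) (closedForm-level-suc t e u u<K)) (closedForm-level-end t e)

lemma1 : (p t : ℕ) → p + t ≤ 64 → (u : ℕ) → u ≤ K p t →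
    sumRange (ρ p t) u (K p t)
      ≡ ((+ (2 ^ t) ℤ.* (+ 1 ℤ.- + t ℤ.+ + h p t u)) ℤ.- + u) /2^ h p t u
lemma1 p t p+t≤64 u =
  subst₂ (λ M n → u ≤ n → sumRange (λ k → (+ 1) /2^ level t M k) u n ≡ closedForm t (level t M u) u)
         (sym 64∸p≡t+e) (sym K≡[1+e]*2^t) (sumRange-level t e u)
  where
  t≤64∸p : t ≤ 64 ∸ p
  t≤64∸p = ℕP.m+n≤o⇒m≤o∸n t (subst (_≤ 64) (ℕP.+-comm p t) p+t≤64)
  e : ℕ
  e = 64 ∸ p ∸ t
  64∸p≡t+e : 64 ∸ p ≡ t + e
  64∸p≡t+e = sym (ℕP.m+[n∸m]≡n t≤64∸p)
  K≡[1+e]*2^t : K p t ≡ suc e * 2 ^ t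
  K≡[1+e]*2^t = cong (_* 2 ^ t) (trans (cong (_∸ t) (ℕP.+-∸-assoc 1 (ℕP.m+n≤o⇒m≤o p p+t≤64)))
                                       (ℕP.+-∸-assoc 1 t≤64∸p))
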